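{- Let $\mathcal{M}$ be a non-orientable regular map of type $\{p,q\}$. If one of $p$ or $q$ is odd, then $\mathcal{M}$ contains a closed walk of odd length that traces an odd number of edges of colour $1$.
   Context: A $3$-maniplex is a connected $3$-valent simple graph with a proper edge-colouring by $\{0,1,2\}$ such that the edges of colours $0$ and $2$ form a disjoint union of $4$-cycles; vertices are flags. A regular map is a $3$-maniplex whose colour-preserving automorphism group is transitive on flags; it is non-orientable if the graph is not bipartite; it has type $\{p,q\}$ if the components of the subgraph of edges of colours $0,1$ are cycles of length $2p$ and those of colours $1,2$ are cycles of length $2q$. Edges of colour $1$ are called $1$-edges; a walk traces the edges between consecutive vertices (counted with multiplicity). -}

module Defs where

open import Data.Nat using (ℕ; zero; suc; _+_; _*_; _<_; _%_)
open import Data.Fin using (Fin; zero; suc)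
open import Data.Bool using (Bool)
open import Data.Product using (Σ; ∃; _×_; _,_)
open import Relation.Binary.PropositionalEquality using (_≡_; _≢_)
open import Relation.Nullary using (¬_)

Colour : Set
Colour = Fin 3

c0 c1 c2 : Colour
c0 = zero
c1 = suc zero
c2 = suc (suc zero)

Odd : ℕ → Set
Odd n = n % 2 ≡ 1

-- Flag-adjacency data on the flag set Fin n.  Since the graph is 3-valent
-- with a proper edge colouring by {0,1,2}, each flag x has exactly one
-- neighbour  r i x  along an edge of colour i.
module _ {n : ℕ} (r : Colour → Fin n → Fin n) where

  data Walk : Fin n → Fin n → Set where
    []  : ∀ {x} → Walk x x
    _∷_ : ∀ {x y} (i : Colour) → Walk (r i x) y → Walk x y

  len : ∀ {x y} → Walk x y → ℕ
  len []      = 0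
  len (_ ∷ w) = suc (len w)

  ones : ∀ {x y} → Walk x y → ℕ
  ones []                = 0
  ones (zero ∷ w)        = ones w
  ones (suc zero ∷ w)    = suc (ones w)
  ones (suc (suc _) ∷ w) = ones w

  iter2 : Colour → Colour → ℕ → Fin n → Fin n
  iter2 i j zero    x = x
  iter2 i j (suc k) x = r i (r j (iter2 i j k x))

  -- The component through x of the subgraph of colours i,j is a cycle of
  -- length 2m: alternating j/i steps return to x after exactly 2m steps
  -- and not earlier.
  AltCycleLength : Colour → Colour → ℕ → Fin n → Set
  AltCycleLength i j m x =
    (0 < m) × (iter2 i j m x ≡ x) × (∀ k → 0 < k → k < m → iter2 i j k x ≢ x)

record Maniplex3 (n : ℕ) : Set where
  field
    r           : Colour → Fin n → Fin n
    involutive  : ∀ i x → r i (r i x) ≡ x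
    no-loops    : ∀ i x → r i x ≢ x
    -- simple graph: no two edges (of different colours) join the same pair
    simple      : ∀ i j x → r i x ≡ r j x → i ≡ j
    -- colours 0 and 2 form disjoint 4-cycles  x, r0 x, r2 r0 x, r0 r2 r0 x
    -- (the four vertices are distinct by no-loops and simple)
    cycle02     : ∀ x → r c2 (r c0 (r c2 (r c0 x))) ≡ x
    connected   : ∀ x y → Walk r x y

open Maniplex3 public

record Automorphism {n : ℕ} (M : Maniplex3 n) : Set where
  field
    φ         : Fin n → Fin n
    φ⁻¹       : Fin n → Fin n
    inverseˡ  : ∀ x → φ⁻¹ (φ x) ≡ x
    inverseʳ  : ∀ x → φ (φ⁻¹ x) ≡ x
    preserves : ∀ i x → φ (r M i x) ≡ r M i (φ x)

IsRegular : ∀ {n} → Maniplex3 n → Set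
IsRegular M = ∀ x y → Σ (Automorphism M) (λ a → Automorphism.φ a x ≡ y)

Bipartite : ∀ {n} → Maniplex3 n → Set
Bipartite {n} M = Σ (Fin n → Bool) (λ col → ∀ i x → col (r M i x) ≢ col x)

NonOrientable : ∀ {n} → Maniplex3 n → Set
NonOrientable M = ¬ Bipartite M

-- Type {p,q}: components of the (0,1)-subgraph are cycles of length 2p and
-- those of the (1,2)-subgraph are cycles of length 2q.
HasType : ∀ {n} → Maniplex3 n → ℕ → ℕ → Set
HasType M p q =
  (∀ x → AltCycleLength (r M) c0 c1 p x) × (∀ x → AltCycleLength (r M) c1 c2 q x)

{-# OPTIONS --safe #-}
-- A non-bipartite connected graph has a closed walk of odd length: colour every
-- flag by the parity of a fixed walk to it from a base flag; some edge must be
-- monochromatic, and going round it one way or the other gives two closed walks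
-- whose lengths differ by one. If p (say) is odd, the (0,1)-cycle through the
-- base flag has even length 2p and traces p edges of colour 1; appending it to
-- the odd walk if necessary corrects the parity of the number of 1-edges while
-- keeping the length odd.
module Submission where

open import Defs
open import Data.Nat using (ℕ)
open import Data.Fin using (Fin)
open import Data.Sum using (_⊎_)
open import Data.Product using (Σ; _×_)

open import Data.Bool using (Bool; true; false)
open import Data.Empty using (⊥-elim)
open import Data.Fin using (zero; suc)
open import Data.Fin.Properties using (any?)
open import Data.Nat using (zero; suc; _+_; parity)
import Data.Nat.Properties as ℕ
open import Data.Parity.Base as ℙ using (Parity; 0ℙ; 1ℙ)
open import Data.Parity.Properties as ℙ using (+-homo-+)
open import Data.Product using (∃; _,_; proj₁; proj₂)
open import Data.Sum using (inj₁; inj₂; [_,_]′)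
open import Function using (id; _∘_)
open import Relation.Binary.PropositionalEquality using (_≡_; refl; sym; trans; cong; subst; module ≡-Reasoning)
open import Relation.Nullary using (¬_; yes; no)

parity-suc : ∀ n → parity (suc n) ≡ parity n ℙ.+ 1ℙ
parity-suc n = trans (cong parity (ℕ.+-comm 1 n)) (+-homo-+ n 1)

Odd⇒parity≡1ℙ : ∀ n → Odd n → parity n ≡ 1ℙ
Odd⇒parity≡1ℙ (suc zero)    _   = refl
Odd⇒parity≡1ℙ (suc (suc n)) odd = Odd⇒parity≡1ℙ n odd

parity≡1ℙ⇒Odd : ∀ n → parity n ≡ 1ℙ → Odd n
parity≡1ℙ⇒Odd (suc zero)    _  = refl
parity≡1ℙ⇒Odd (suc (suc n)) eq = parity≡1ℙ⇒Odd n eq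

module Walks {n : ℕ} (r : Colour → Fin n → Fin n) where

  infixr 5 _++_ _++ᵖ_

  _++_ : ∀ {x y z} → Walk r x y → Walk r y z → Walk r x z
  []      ++ v = v
  (i ∷ w) ++ v = i ∷ (w ++ v)

  len-++ : ∀ {x y z} (w : Walk r x y) (v : Walk r y z) →
           len r (w ++ v) ≡ len r w + len r v
  len-++ []      v = refl
  len-++ (i ∷ w) v = cong suc (len-++ w v)

  ones-++ : ∀ {x y z} (w : Walk r x y) (v : Walk r y z) →
            ones r (w ++ v) ≡ ones r w + ones r v
  ones-++ []                v = refl
  ones-++ (zero ∷ w)        v = ones-++ w v
  ones-++ (suc zero ∷ w)    v = cong suc (ones-++ w v)
  ones-++ (suc (suc _) ∷ w) v = ones-++ w v

  parity-len-++ : ∀ {x y z} (w : Walk r x y) (v : Walk r y z) →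
                  parity (len r (w ++ v)) ≡ parity (len r w) ℙ.+ parity (len r v)
  parity-len-++ w v = trans (cong parity (len-++ w v)) (+-homo-+ (len r w) (len r v))

  parity-ones-++ : ∀ {x y z} (w : Walk r x y) (v : Walk r y z) →
                   parity (ones r (w ++ v)) ≡ parity (ones r w) ℙ.+ parity (ones r v)
  parity-ones-++ w v = trans (cong parity (ones-++ w v)) (+-homo-+ (ones r w) (ones r v))

  WalkOfParity : Fin n → Fin n → Parity → Parity → Set
  WalkOfParity x y a o =
    Σ (Walk r x y) (λ w → parity (len r w) ≡ a × parity (ones r w) ≡ o)

  _++ᵖ_ : ∀ {x y z a b o p} → WalkOfParity x y a o → WalkOfParity y z b p →
          WalkOfParity x z (a ℙ.+ b) (o ℙ.+ p)
  (w , refl , refl) ++ᵖ (v , refl , refl) = w ++ v , parity-len-++ w v , parity-ones-++ w v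

  odd-of-either : ∀ {x} (w v : Walk r x x) →
                  parity (len r v) ≡ parity (len r w) ℙ.+ 1ℙ → ∃ (WalkOfParity x x 1ℙ)
  odd-of-either w v v≡w+1 with parity (len r w) in w-parity
  ... | 0ℙ = _ , v , v≡w+1 , refl
  ... | 1ℙ = _ , w , w-parity , refl

  withOddOnes : ∀ {x a o} → WalkOfParity x x a o → WalkOfParity x x 0ℙ 1ℙ →
                WalkOfParity x x a 1ℙ
  withOddOnes {o = 1ℙ}         w _ = w
  withOddOnes {x} {a} {o = 0ℙ} w c =
    subst (λ a → WalkOfParity x x a 1ℙ) (ℙ.+-identityʳ a) (w ++ᵖ c)

  module _ (i j : Colour) (one-per-round : ∀ {y} → ones r {y} (j ∷ (i ∷ [])) ≡ 1) where

    alternatingWalk : ∀ k x → WalkOfParity x (iter2 r i j k x) 0ℙ (parity k)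
    alternatingWalk zero    x = [] , refl , refl
    alternatingWalk (suc k) x =
      subst (WalkOfParity x (iter2 r i j (suc k) x) 0ℙ) (sym (parity-suc k))
            (alternatingWalk k x ++ᵖ ((j ∷ (i ∷ [])) , refl , cong parity one-per-round))

    alternatingCycle : ∀ m {x} → iter2 r i j m x ≡ x → WalkOfParity x x 0ℙ (parity m)
    alternatingCycle m {x} closes =
      subst (λ y → WalkOfParity x y 0ℙ (parity m)) closes (alternatingWalk m x)

parityColour : Parity → Bool
parityColour 0ℙ = false
parityColour 1ℙ = true

parityColour-injective : ∀ {a b} → parityColour a ≡ parityColour b → a ≡ b
parityColour-injective {0ℙ} {0ℙ} _ = refl
parityColour-injective {1ℙ} {1ℙ} _ = refl

module _ {n : ℕ} (M : Maniplex3 n) where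

  open Walks (r M)

  evenClosedWalkWithOddOnes : ∀ {p q} → HasType M p q → Odd p ⊎ Odd q →
                              ∀ x → WalkOfParity x x 0ℙ 1ℙ
  evenClosedWalkWithOddOnes {p} (type01 , _) (inj₁ odd-p) x =
    subst (WalkOfParity x x 0ℙ) (Odd⇒parity≡1ℙ p odd-p)
          (alternatingCycle c0 c1 refl p (proj₁ (proj₂ (type01 x))))
  evenClosedWalkWithOddOnes {q = q} (_ , type12) (inj₂ odd-q) x =
    subst (WalkOfParity x x 0ℙ) (Odd⇒parity≡1ℙ q odd-q)
          (alternatingCycle c1 c2 refl q (proj₁ (proj₂ (type12 x))))

  module _ (base : Fin n) where

    private
      depth : Fin n → Parity
      depth y = parity (len (r M) (connected M base y))

    monochromaticEdge⇒oddClosedWalk : ∀ i x → depth (r M i x) ≡ depth x →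
                                      ∃ (WalkOfParity base base 1ℙ)
    monochromaticEdge⇒oddClosedWalk i x same = odd-of-either direct viaEdge parities
      where
        back : Walk (r M) (r M i x) base
        back = connected M (r M i x) base

        direct viaEdge : Walk (r M) base base
        direct  = connected M base (r M i x) ++ back
        viaEdge = connected M base x ++ (i ∷ back)

        e : Parity
        e = parity (len (r M) back)

        open ≡-Reasoning

        parities : parity (len (r M) viaEdge) ≡ parity (len (r M) direct) ℙ.+ 1ℙ
        parities = begin
          parity (len (r M) viaEdge)
            ≡⟨ parity-len-++ (connected M base x) (i ∷ back) ⟩
          depth x ℙ.+ parity (suc (len (r M) back))
            ≡⟨ cong (depth x ℙ.+_) (parity-suc (len (r M) back)) ⟩
          depth x ℙ.+ (e ℙ.+ 1ℙ)
            ≡⟨ cong (ℙ._+ (e ℙ.+ 1ℙ)) (sym same) ⟩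
          depth (r M i x) ℙ.+ (e ℙ.+ 1ℙ)
            ≡⟨ sym (ℙ.+-assoc (depth (r M i x)) e 1ℙ) ⟩
          depth (r M i x) ℙ.+ e ℙ.+ 1ℙ
            ≡⟨ cong (ℙ._+ 1ℙ) (sym (parity-len-++ (connected M base (r M i x)) back)) ⟩
          parity (len (r M) direct) ℙ.+ 1ℙ
            ∎

    bipartite⊎oddClosedWalk : Bipartite M ⊎ ∃ (WalkOfParity base base 1ℙ)
    bipartite⊎oddClosedWalk
      with any? (λ i → any? (λ x → depth (r M i x) ℙ.≟ depth x))
    ... | yes (i , x , same) = inj₂ (monochromaticEdge⇒oddClosedWalk i x same)
    ... | no none =
      inj₁ (parityColour ∘ depth , λ i x same → none (i , x , parityColour-injective same))

nonBipartite⇒oddClosedWalk : ∀ {n} (M : Maniplex3 n) → ¬ Bipartite M →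
                             Σ (Fin n) (λ x → ∃ (Walks.WalkOfParity (r M) x x 1ℙ))
nonBipartite⇒oddClosedWalk {zero}  M notBipartite = ⊥-elim (notBipartite ((λ ()) , λ _ ()))
nonBipartite⇒oddClosedWalk {suc _} M notBipartite =
  zero , [ ⊥-elim ∘ notBipartite , id ]′ (bipartite⊎oddClosedWalk M zero)

lemma6p1 : (n : ℕ) (M : Maniplex3 n) (p q : ℕ) →
    IsRegular M → NonOrientable M → HasType M p q → (Odd p ⊎ Odd q) →
    Σ (Fin n) (λ x → Σ (Walk (Maniplex3.r M) x x) (λ w → Odd (len (Maniplex3.r M) w) × Odd (ones (Maniplex3.r M) w)))
lemma6p1 n M p q _ nonOrientable type oddFace
  with x , _ , oddWalk ← nonBipartite⇒oddClosedWalk M nonOrientable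
  with w , oddLength , oddOnes ←
         Walks.withOddOnes (r M) oddWalk (evenClosedWalkWithOddOnes M type oddFace x)
  = x , w , parity≡1ℙ⇒Odd (len (r M) w) oddLength , parity≡1ℙ⇒Odd (ones (r M) w) oddOnes
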